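{- Let $n\geq 2$ be an integer. Then $$\binom{n^3-\lfloor \frac{(n-1)^3+1}{2}\rfloor}{3n^2-3n+1}+\binom{n^3-\lfloor \frac{(n-1)^3+2}{2}\rfloor}{3n^2-3n+1}<n^{3n^2}.$$ -}

module Defs where

-- Write n = p + 1 and K = 3p² + 3p + 1 = n³ − p³. Both binomial coefficients are
-- of the form C(m, K) with 2m ≤ p³ + 2K. Since the K factors of (2K)!/K! are each at
-- least K and C(2K, K) ≤ 4^K, we get K^K ≤ 4^K K!, hence C(m, K) ≤ m^K / K! ≤ (4m/K)^K.
-- For p ≥ 8 the cubic p³ − 6p² − 8p − 3 is positive, i.e. 4m ≤ nK, so each coefficient
-- is at most n^K and their sum is at most 2n^K < n^(K+1) ≤ n^(3n²).
-- The cases n ≤ 8 are decided by evaluation.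
module Submission where

open import Defs
open import Data.Nat using (ℕ; _+_; _*_; _∸_; _^_; _≤_; _<_)
open import Data.Nat.DivMod using (_/_)
open import Data.Nat.Combinatorics using (_C_)

open import Data.Nat.Base using (zero; suc; _!; z≤n; s≤s; s≤s⁻¹)
open import Data.Nat.Properties
open import Data.Nat.DivMod using (_%_; m≡m%n+[m/n]*n; m%n<n; m*[n/m]≡n)
open import Data.Nat.Combinatorics
  using (_P_; nCk≡nPk/k!; nPk≡n!/[n∸k]!; k>n⇒nCk≡0; nCk+nC[k+1]≡[n+1]C[k+1])
open import Data.Nat.Combinatorics.Base using (_P′_)
open import Data.Nat.Combinatorics.Specification using (nP′k≡n!/[n∸k]!; k!∣nP′k)
open import Data.Nat.Tactic.RingSolver using (solve-∀)
open import Data.Product using (_,_)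
open import Data.Sum using (inj₁; inj₂)
open import Data.Unit using (tt)
open import Relation.Binary.PropositionalEquality

^-distrib-* : ∀ m n k → (m * n) ^ k ≡ m ^ k * n ^ k
^-distrib-* m n zero    = refl
^-distrib-* m n (suc k) = begin
  (m * n) * (m * n) ^ k      ≡⟨ cong ((m * n) *_) (^-distrib-* m n k) ⟩
  (m * n) * (m ^ k * n ^ k)  ≡⟨ interchange m n (m ^ k) (n ^ k) ⟩
  (m * m ^ k) * (n * n ^ k)  ∎
  where
  open ≡-Reasoning
  interchange : ∀ a b c d → (a * b) * (c * d) ≡ (a * c) * (b * d)
  interchange = solve-∀

nP′k≤n^k : ∀ n k → n P′ k ≤ n ^ k
nP′k≤n^k n zero    = ≤-refl
nP′k≤n^k n (suc k) = *-mono-≤ (m∸n≤m n k) (nP′k≤n^k n k)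

[n∸k]^k≤nP′k : ∀ n k → (n ∸ k) ^ k ≤ n P′ k
[n∸k]^k≤nP′k n zero    = ≤-refl
[n∸k]^k≤nP′k n (suc k) =
  *-mono-≤ n∸[1+k]≤n∸k (≤-trans (^-monoˡ-≤ k n∸[1+k]≤n∸k) ([n∸k]^k≤nP′k n k))
  where
  n∸[1+k]≤n∸k : n ∸ suc k ≤ n ∸ k
  n∸[1+k]≤n∸k = ∸-monoʳ-≤ n (n≤1+n k)

k!*nCk≡nP′k : ∀ {n k} → k ≤ n → k ! * (n C k) ≡ n P′ k
k!*nCk≡nP′k {n} {k} k≤n = begin
  k ! * (n C k)           ≡⟨ cong (k ! *_) (nCk≡nPk/k! k≤n) ⟩
  k ! * ((n P k) / k !)   ≡⟨ cong (λ x → k ! * (x / k !)) nPk≡nP′k ⟩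
  k ! * ((n P′ k) / k !)  ≡⟨ m*[n/m]≡n (k!∣nP′k k≤n) ⟩
  n P′ k                  ∎
  where
  open ≡-Reasoning
  instance _ = k !≢0
  nPk≡nP′k : n P k ≡ n P′ k
  nPk≡nP′k = trans (nPk≡n!/[n∸k]! k≤n) (sym (nP′k≡n!/[n∸k]! k≤n))

k!*nCk≤n^k : ∀ n k → k ! * (n C k) ≤ n ^ k
k!*nCk≤n^k n k with ≤-<-connex k n
... | inj₁ k≤n = ≤-trans (≤-reflexive (k!*nCk≡nP′k k≤n)) (nP′k≤n^k n k)
... | inj₂ n<k rewrite k>n⇒nCk≡0 n<k | *-zeroʳ (k !) = z≤n

nCk≤2^n : ∀ n k → n C k ≤ 2 ^ n
nCk≤2^n zero    zero    = ≤-refl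
nCk≤2^n zero    (suc k) = z≤n
nCk≤2^n (suc n) zero    = m^n>0 2 (suc n)
nCk≤2^n (suc n) (suc k) = begin
  suc n C suc k          ≡⟨ nCk+nC[k+1]≡[n+1]C[k+1] n k ⟨
  n C k + n C suc k      ≤⟨ +-mono-≤ (nCk≤2^n n k) (nCk≤2^n n (suc k)) ⟩
  2 ^ n + 2 ^ n          ≡⟨ cong (2 ^ n +_) (+-identityʳ (2 ^ n)) ⟨
  2 * 2 ^ n              ∎
  where open ≤-Reasoning

k^k≤4^k*k! : ∀ k → k ^ k ≤ 4 ^ k * k !
k^k≤4^k*k! k = begin
  k ^ k                  ≡⟨ cong (_^ k) (m+n∸n≡m k k) ⟨
  (k + k ∸ k) ^ k        ≤⟨ [n∸k]^k≤nP′k (k + k) k ⟩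
  (k + k) P′ k           ≡⟨ k!*nCk≡nP′k (m≤n+m k k) ⟨
  k ! * ((k + k) C k)    ≤⟨ *-monoʳ-≤ (k !) (nCk≤2^n (k + k) k) ⟩
  k ! * 2 ^ (k + k)      ≡⟨ cong (k ! *_) (^-distribˡ-+-* 2 k k) ⟩
  k ! * (2 ^ k * 2 ^ k)  ≡⟨ cong (k ! *_) (^-distrib-* 2 2 k) ⟨
  k ! * 4 ^ k            ≡⟨ *-comm (k !) (4 ^ k) ⟩
  4 ^ k * k !            ∎
  where open ≤-Reasoning

mCk≤n^k : ∀ {m n} k → 4 * m ≤ n * k → m C k ≤ n ^ k
mCk≤n^k zero          _      = ≤-refl
mCk≤n^k {m} {n} k@(suc _) 4m≤nk = *-cancelˡ-≤ (k ^ k) {{m^n≢0 k k}} (begin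
  k ^ k * (m C k)            ≤⟨ *-monoˡ-≤ (m C k) (k^k≤4^k*k! k) ⟩
  (4 ^ k * k !) * (m C k)    ≡⟨ *-assoc (4 ^ k) (k !) (m C k) ⟩
  4 ^ k * (k ! * (m C k))    ≤⟨ *-monoʳ-≤ (4 ^ k) (k!*nCk≤n^k m k) ⟩
  4 ^ k * m ^ k              ≡⟨ ^-distrib-* 4 m k ⟨
  (4 * m) ^ k                ≤⟨ ^-monoˡ-≤ k 4m≤nk ⟩
  (n * k) ^ k                ≡⟨ ^-distrib-* n k k ⟩
  n ^ k * k ^ k              ≡⟨ *-comm (n ^ k) (k ^ k) ⟩
  k ^ k * n ^ k              ∎)
  where open ≤-Reasoning

shell : ℕ → ℕ
shell p = 3 * (p * p) + 3 * p + 1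

[1+p]^3≡p^3+shell : ∀ p → suc p ^ 3 ≡ p ^ 3 + shell p
[1+p]^3≡p^3+shell = expand
  where
  expand : ∀ p → (1 + p) * ((1 + p) * ((1 + p) * 1)) ≡ p * (p * (p * 1)) + (3 * (p * p) + 3 * p + 1)
  expand = solve-∀

3[1+p]^2∸3[1+p]+1≡shell : ∀ p → 3 * suc p ^ 2 ∸ 3 * suc p + 1 ≡ shell p
3[1+p]^2∸3[1+p]+1≡shell p = begin
  3 * suc p ^ 2 ∸ 3 * suc p + 1                        ≡⟨ cong (λ x → x ∸ 3 * suc p + 1) (expand p) ⟩
  (3 * (p * p) + 3 * p) + 3 * suc p ∸ 3 * suc p + 1    ≡⟨ cong (_+ 1) (m+n∸n≡m (3 * (p * p) + 3 * p) (3 * suc p)) ⟩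
  shell p                                              ∎
  where
  open ≡-Reasoning
  expand : ∀ p → 3 * ((1 + p) * ((1 + p) * 1)) ≡ (3 * (p * p) + 3 * p) + 3 * (1 + p)
  expand = solve-∀

1+shell≤3[1+p]^2 : ∀ p → suc (shell p) ≤ 3 * suc p ^ 2
1+shell≤3[1+p]^2 p = subst (suc (shell p) ≤_) (sym (expand p)) (m≤m+n (suc (shell p)) (3 * p + 1))
  where
  expand : ∀ p → 3 * ((1 + p) * ((1 + p) * 1)) ≡ (1 + (3 * (p * p) + 3 * p + 1)) + (3 * p + 1)
  expand = solve-∀

m≤2*[[m+d]/2] : ∀ m {d} → 1 ≤ d → m ≤ 2 * ((m + d) / 2)
m≤2*[[m+d]/2] m {d} 1≤d = +-cancelʳ-≤ d m (2 * q) (begin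
  m + d              ≡⟨ m≡m%n+[m/n]*n (m + d) 2 ⟩
  (m + d) % 2 + q * 2 ≤⟨ +-monoˡ-≤ (q * 2) (≤-trans (s≤s⁻¹ (m%n<n (m + d) 2)) 1≤d) ⟩
  d + q * 2          ≡⟨ +-comm d (q * 2) ⟩
  q * 2 + d          ≡⟨ cong (_+ d) (*-comm q 2) ⟩
  2 * q + d          ∎)
  where
  open ≤-Reasoning
  q = (m + d) / 2

2*[c+k∸[c+d]/2]≤c+k+k : ∀ c k {d} → 1 ≤ d → 2 * (c + k ∸ (c + d) / 2) ≤ c + k + k
2*[c+k∸[c+d]/2]≤c+k+k c k {d} 1≤d = begin
  2 * (c + k ∸ q)        ≡⟨ *-distribˡ-∸ 2 (c + k) q ⟩
  2 * (c + k) ∸ 2 * q    ≤⟨ ∸-monoʳ-≤ (2 * (c + k)) (m≤2*[[m+d]/2] c 1≤d) ⟩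
  2 * (c + k) ∸ c        ≡⟨ cong (_∸ c) (expand c k) ⟩
  c + k + k + c ∸ c      ≡⟨ m+n∸n≡m (c + k + k) c ⟩
  c + k + k              ∎
  where
  open ≤-Reasoning
  q = (c + d) / 2
  expand : ∀ c k → 2 * (c + k) ≡ c + k + k + c
  expand = solve-∀

2[p^3+2shell]≤[1+p]shell : ∀ {p} → 8 ≤ p → 2 * (p ^ 3 + shell p + shell p) ≤ suc p * shell p
2[p^3+2shell]≤[1+p]shell 8≤p with m≤n⇒∃[o]m+o≡n 8≤p
... | r , refl = subst (2 * (p ^ 3 + shell p + shell p) ≤_) (expand r) (m≤m+n _ _)
  where
  p = 8 + r
  expand : ∀ r → let p = 8 + r; k = 3 * (p * p) + 3 * p + 1 in
           2 * (p * (p * (p * 1)) + k + k) + (r * r * r + 18 * (r * r) + 88 * r + 61) ≡ (1 + p) * k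
  expand = solve-∀

binomial≤[1+p]^shell : ∀ p {d} → 8 ≤ p → 1 ≤ d →
  (suc p ^ 3 ∸ (p ^ 3 + d) / 2) C (3 * suc p ^ 2 ∸ 3 * suc p + 1) ≤ suc p ^ shell p
binomial≤[1+p]^shell p {d} 8≤p 1≤d = begin
  (suc p ^ 3 ∸ (p ^ 3 + d) / 2) C (3 * suc p ^ 2 ∸ 3 * suc p + 1)
      ≡⟨ cong₂ (λ a b → (a ∸ (p ^ 3 + d) / 2) C b) ([1+p]^3≡p^3+shell p) (3[1+p]^2∸3[1+p]+1≡shell p) ⟩
  m C shell p
      ≤⟨ mCk≤n^k (shell p) 4m≤[1+p]shell ⟩
  suc p ^ shell p ∎
  where
  open ≤-Reasoning
  m = p ^ 3 + shell p ∸ (p ^ 3 + d) / 2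
  4m≤[1+p]shell : 4 * m ≤ suc p * shell p
  4m≤[1+p]shell = begin
    4 * m                                  ≡⟨ *-assoc 2 2 m ⟩
    2 * (2 * m)                            ≤⟨ *-monoʳ-≤ 2 (2*[c+k∸[c+d]/2]≤c+k+k (p ^ 3) (shell p) 1≤d) ⟩
    2 * (p ^ 3 + shell p + shell p)        ≤⟨ 2[p^3+2shell]≤[1+p]shell 8≤p ⟩
    suc p * shell p                        ∎

proposition4 : (n : ℕ) → 2 ≤ n →
    (n ^ 3 ∸ (((n ∸ 1) ^ 3 + 1) / 2)) C (3 * n ^ 2 ∸ 3 * n + 1)
    + (n ^ 3 ∸ (((n ∸ 1) ^ 3 + 2) / 2)) C (3 * n ^ 2 ∸ 3 * n + 1)
    < n ^ (3 * n ^ 2)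
proposition4 1 (s≤s ())
proposition4 2 _ = <ᵇ⇒< _ _ tt
proposition4 3 _ = <ᵇ⇒< _ _ tt
proposition4 4 _ = <ᵇ⇒< _ _ tt
proposition4 5 _ = <ᵇ⇒< _ _ tt
proposition4 6 _ = <ᵇ⇒< _ _ tt
proposition4 7 _ = <ᵇ⇒< _ _ tt
proposition4 8 _ = <ᵇ⇒< _ _ tt
proposition4 n@(suc p@(suc (suc (suc (suc (suc (suc (suc (suc r))))))))) _ = begin-strict
  binomial 1 + binomial 2     ≤⟨ +-mono-≤ (binomial≤[1+p]^shell p 8≤p (s≤s z≤n)) (binomial≤[1+p]^shell p 8≤p (s≤s z≤n)) ⟩
  n ^ shell p + n ^ shell p    ≡⟨ cong (n ^ shell p +_) (+-identityʳ (n ^ shell p)) ⟨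
  2 * n ^ shell p              <⟨ *-monoˡ-< (n ^ shell p) {{m^n≢0 n (shell p)}} (m≤m+n 3 (6 + r)) ⟩
  n * n ^ shell p              ≤⟨ ^-monoʳ-≤ n (1+shell≤3[1+p]^2 p) ⟩
  n ^ (3 * n ^ 2)              ∎
  where
  open ≤-Reasoning
  binomial : ℕ → ℕ
  binomial d = (n ^ 3 ∸ (((n ∸ 1) ^ 3 + d) / 2)) C (3 * n ^ 2 ∸ 3 * n + 1)
  8≤p : 8 ≤ p
  8≤p = m≤m+n 8 r
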